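{- Let $G=(V,E)$ be an $n$-vertex graph, let $\delta_{\mathrm{in}}>0$ and $\delta_{\mathrm{out}}=\delta_{\mathrm{in}}^5/10^8$. Let $V'\subseteq V$, let $A'\subseteq V'$ and $D'=V'\setminus A'$. Suppose $\mu(G[A'])\ge\delta_{\mathrm{in}}n/2$. Then for any matching $M$ in $G[V']$, if $|M[A']|<3\delta_{\mathrm{out}}n$ and $\mu(G[A'\setminus V(M)])<16\delta_{\mathrm{out}}n$, then $|M[A',D']|\ge\delta_{\mathrm{in}}n/3$.
   Context: $\mu(H)$ is the maximum matching size of $H$; $G[S]$ is the induced subgraph; $V(M)$ the set of vertices matched by $M$. For a matching $M$ and vertex sets $U_1,U_2$, $M[U_1]$ is the set of edges of $M$ with both endpoints in $U_1$, and $M[U_1,U_2]$ is the set of edges of $M$ with one endpoint in $U_1$ and the other in $U_2$.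
   Formalization: The parameter $\delta_{\mathrm{in}}$ ranges over the positive rationals. -}

module Defs where

open import Data.Nat using (ℕ)
open import Data.Fin using (Fin)
open import Data.Fin.Subset using (Subset; _∈_; _∉_; _─_; ⁅_⁆; ⋃)
open import Data.Fin.Subset.Properties using (_∈?_)
open import Data.Bool using (Bool; true; false; _∧_; _∨_)
open import Data.Product using (_×_; _,_; Σ)
open import Data.List using (List; []; _∷_; length; filter; concatMap)
open import Data.List.Relation.Unary.All using (All)
open import Data.List.Relation.Unary.Unique.Propositional using (Unique)
open import Data.Integer using (+_)
open import Data.Rational using (ℚ; _/_; _*_)
open import Relation.Nullary using (¬_)
open import Relation.Nullary.Decidable using (⌊_⌋; _×-dec_; _⊎-dec_)
open import Relation.Binary.PropositionalEquality using (_≡_)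
open import Data.Sum using (_⊎_)

record Graph (n : ℕ) : Set₁ where
  field
    Adj     : Fin n → Fin n → Set
    sym     : ∀ {u v} → Adj u v → Adj v u
    irrefl  : ∀ {u} → ¬ Adj u u
open Graph public

Edge : ℕ → Set
Edge n = Fin n × Fin n

endpoints : ∀ {n} → List (Edge n) → List (Fin n)
endpoints = concatMap (λ { (u , v) → u ∷ v ∷ [] })

covered : ∀ {n} → List (Edge n) → Subset n
covered M = ⋃ (Data.List.map ⁅_⁆ (endpoints M))
  where import Data.List

-- M is a matching of the induced subgraph G[S]: every element is an edge of G with
-- both endpoints in S, and no vertex is covered twice (so edges are pairwise disjoint).
IsMatchingIn : ∀ {n} → Graph n → Subset n → List (Edge n) → Set
IsMatchingIn G S M =
  All (λ { (u , v) → Adj G u v × u ∈ S × v ∈ S }) M × Unique (endpoints M)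

MaxMatchingSize : ∀ {n} → Graph n → Subset n → ℕ → Set
MaxMatchingSize G S m =
  Σ (List (Edge _)) (λ M → IsMatchingIn G S M × length M ≡ m)
  × (∀ M → IsMatchingIn G S M → Data.Nat._≤_ (length M) m)
  where import Data.Nat

inside : ∀ {n} → Subset n → List (Edge n) → List (Edge n)
inside U = filter (λ { (u , v) → (u ∈? U) ×-dec (v ∈? U) })

between : ∀ {n} → Subset n → Subset n → List (Edge n) → List (Edge n)
between U₁ U₂ = filter (λ { (u , v) →
  ((u ∈? U₁) ×-dec (v ∈? U₂)) ⊎-dec ((u ∈? U₂) ×-dec (v ∈? U₁)) })

ℕ→ℚ : ℕ → ℚ
ℕ→ℚ k = + k / 1

δout : ℚ → ℚ
δout d = d * d * d * d * d * (+ 1 / 100000000)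

-- Charge every edge of a maximum matching of G[A′] to one of its endpoints in V(M) ∩ A′, if it has
-- one; the uncharged edges form a matching of G[A′ ∖ V(M)], and since a matching has distinct
-- endpoints the charging is injective. Hence μ(G[A′]) ≤ |V(M) ∩ A′| + μ(G[A′ ∖ V(M)]), and since
-- M lives in G[V′] every edge of M meeting A′ lies in M[A′] or in M[A′,D′], so
-- |V(M) ∩ A′| ≤ 2|M[A′]| + |M[A′,D′]|. Thus |M[A′,D′]| > δ_in n/2 − 22 δ_out n. Finally
-- δ_in n ≤ 2 μ(G[A′]) ≤ n, so δ_out n ≤ δ_in n/10⁸ and 22 δ_out n ≤ δ_in n/6.
module Submission where

module Matchings where

  open import Defs hiding (sym)
  open import Data.Nat using (ℕ; suc; _+_; _≤_; z≤n; s≤s)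
  open import Data.Nat.Properties using (+-suc; +-mono-≤; +-monoˡ-≤; ≤-trans)
  open import Data.Fin using (Fin) renaming (_≟_ to _≟ᶠ_)
  open import Data.Fin.Subset using (Subset; _─_; ⁅_⁆; ⋃) renaming (_∈_ to _∈ₛ_; _∉_ to _∉ₛ_)
  open import Data.Fin.Subset.Properties using (_∈?_; x∈p∪q⁻; x∈⁅y⁆⇒x≡y; ∉⊥; x∈p∧x∉q⇒x∈p─q)
  open import Data.List using (List; []; _∷_; length; filter; map; allFin)
  open import Data.List.Properties using (length-removeAt′; length-tabulate)
  open import Data.List.Membership.Propositional using (_∈_; _∉_) renaming (_─_ to _∖_)
  open import Data.List.Membership.Propositional.Properties using (∈-allFin; ∈-filter⁺)
  open import Data.List.Relation.Unary.Any using (here; there; index; any?)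
  open import Data.List.Relation.Unary.All as All using (All; []; _∷_)
  open import Data.List.Relation.Unary.AllPairs using ([]; _∷_)
  open import Data.List.Relation.Unary.Unique.Propositional using (Unique)
  open import Data.Product using (_×_; _,_; proj₁; proj₂)
  open import Data.Sum using (inj₁; inj₂)
  open import Data.Vec using (_∷_; here; there)
  open import Data.Bool using (true; false)
  open import Data.Empty using (⊥-elim)
  open import Relation.Nullary using (Dec; yes; no)
  open import Relation.Binary.PropositionalEquality using (_≡_; _≢_; refl; sym; trans; cong; subst; subst₂)

  module _ {A : Set} where

    there² : ∀ {x y z : A} {xs} → x ∈ xs → x ∈ y ∷ z ∷ xs
    there² x∈xs = there (there x∈xs)

    avoids : ∀ {x : A} {xs ys} → All (x ≢_) xs → All (_∈ xs) ys → All (x ≢_) ys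
    avoids x∉xs = All.map (All.lookup x∉xs)

    ∈-∖⁺ : ∀ {x y : A} {ys} (x∈ys : x ∈ ys) → y ∈ ys → x ≢ y → y ∈ ys ∖ x∈ys
    ∈-∖⁺ (here refl) (here refl) x≢y = ⊥-elim (x≢y refl)
    ∈-∖⁺ (here refl) (there y∈ys) _ = y∈ys
    ∈-∖⁺ (there x∈ys) (here refl) _ = here refl
    ∈-∖⁺ (there x∈ys) (there y∈ys) x≢y = there (∈-∖⁺ x∈ys y∈ys x≢y)

    unique-⊆⇒length≤ : ∀ {xs ys : List A} → Unique xs → All (_∈ ys) xs → length xs ≤ length ys
    unique-⊆⇒length≤ {[]} [] [] = z≤n
    unique-⊆⇒length≤ {x ∷ xs} {ys} (x∉xs ∷ uxs) (x∈ys ∷ xs⊆ys) =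
      subst (suc (length xs) ≤_) (sym (length-removeAt′ ys (index x∈ys)))
        (s≤s (unique-⊆⇒length≤ uxs (All.zipWith (λ (x≢z , z∈ys) → ∈-∖⁺ x∈ys z∈ys x≢z) (x∉xs , xs⊆ys))))

  length-endpoints : ∀ {n} (M : List (Edge n)) → length (endpoints M) ≡ length M + length M
  length-endpoints [] = refl
  length-endpoints (_ ∷ M) = cong suc (trans (cong suc (length-endpoints M)) (sym (+-suc (length M) (length M))))

  ∈-covered⇒∈-endpoints : ∀ {n} {x : Fin n} (M : List (Edge n)) → x ∈ₛ covered M → x ∈ endpoints M
  ∈-covered⇒∈-endpoints M = ∈-⋃⁅⁆ (endpoints M)
    where
    ∈-⋃⁅⁆ : ∀ {n} {x : Fin n} xs → x ∈ₛ ⋃ (map ⁅_⁆ xs) → x ∈ xs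
    ∈-⋃⁅⁆ [] x∈⊥ = ⊥-elim (∉⊥ x∈⊥)
    ∈-⋃⁅⁆ (y ∷ ys) x∈ with x∈p∪q⁻ ⁅ y ⁆ (⋃ (map ⁅_⁆ ys)) x∈
    ... | inj₁ x∈⁅y⁆ = here (x∈⁅y⁆⇒x≡y y x∈⁅y⁆)
    ... | inj₂ x∈ys = there (∈-⋃⁅⁆ ys x∈ys)

  x∈p─q⇒x∉q : ∀ {n} {x : Fin n} {p q : Subset n} → x ∈ₛ p ─ q → x ∉ₛ q
  x∈p─q⇒x∉q {p = _ ∷ p} {q = _ ∷ q} (there x∈p─q) (there x∈q) = x∈p─q⇒x∉q x∈p─q x∈q
  x∈p─q⇒x∉q {p = true ∷ _} {q = true ∷ _} () here
  x∈p─q⇒x∉q {p = false ∷ _} {q = true ∷ _} () here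

  module _ {n : ℕ} (G : Graph n) where

    μ+μ≤n : ∀ {S μ} → MaxMatchingSize G S μ → μ + μ ≤ n
    μ+μ≤n ((M , (_ , unique) , refl) , _) =
      subst₂ _≤_ (length-endpoints M) (length-tabulate (λ x → x))
        (unique-⊆⇒length≤ unique (All.tabulate (λ {x} _ → ∈-allFin x)))

    record Charging (T : Subset n) (L : List (Fin n)) (Ms : List (Edge n)) : Set where
      field
        charged   : List (Fin n)
        survivors : List (Edge n)
        length-≤  : length Ms ≤ length charged + length survivors
        charged-unique        : Unique charged
        charged-⊆-L           : All (_∈ L) charged
        survivors-matching    : IsMatchingIn G T survivors
        charged-⊆-endpoints   : All (_∈ endpoints Ms) charged
        survivors-⊆-endpoints : All (_∈ endpoints Ms) (endpoints survivors)

    charge : ∀ {S T L} → (∀ {x} → x ∈ₛ S → x ∉ L → x ∈ₛ T) →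
             ∀ Ms → IsMatchingIn G S Ms → Charging T L Ms
    charge S∖L⊆T [] _ = record
      { charged = [] ; survivors = [] ; length-≤ = z≤n ; charged-unique = [] ; charged-⊆-L = []
      ; survivors-matching = [] , [] ; charged-⊆-endpoints = [] ; survivors-⊆-endpoints = [] }
    charge {L = L} S∖L⊆T ((a , b) ∷ Ms) ((ab∈E , a∈S , b∈S) ∷ Ms⊆S , (a≢b ∷ a∉Ms) ∷ b∉Ms ∷ unique)
      with charge S∖L⊆T Ms (Ms⊆S , unique) | any? (a ≟ᶠ_) L | any? (b ≟ᶠ_) L
    ... | c | yes a∈L | _ = record
      { charged = a ∷ charged ; survivors = survivors ; length-≤ = s≤s length-≤
      ; charged-unique = avoids a∉Ms charged-⊆-endpoints ∷ charged-unique
      ; charged-⊆-L = a∈L ∷ charged-⊆-L ; survivors-matching = survivors-matching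
      ; charged-⊆-endpoints = here refl ∷ All.map there² charged-⊆-endpoints
      ; survivors-⊆-endpoints = All.map there² survivors-⊆-endpoints }
      where open Charging c
    ... | c | no _ | yes b∈L = record
      { charged = b ∷ charged ; survivors = survivors ; length-≤ = s≤s length-≤
      ; charged-unique = avoids b∉Ms charged-⊆-endpoints ∷ charged-unique
      ; charged-⊆-L = b∈L ∷ charged-⊆-L ; survivors-matching = survivors-matching
      ; charged-⊆-endpoints = there (here refl) ∷ All.map there² charged-⊆-endpoints
      ; survivors-⊆-endpoints = All.map there² survivors-⊆-endpoints }
      where open Charging c
    ... | c | no a∉L | no b∉L = record
      { charged = charged ; survivors = (a , b) ∷ survivors
      ; length-≤ = subst (suc (length Ms) ≤_) (sym (+-suc (length charged) (length survivors))) (s≤s length-≤)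
      ; charged-unique = charged-unique ; charged-⊆-L = charged-⊆-L
      ; survivors-matching =
          (ab∈E , S∖L⊆T a∈S a∉L , S∖L⊆T b∈S b∉L) ∷ proj₁ survivors-matching ,
          (a≢b ∷ avoids a∉Ms survivors-⊆-endpoints) ∷ avoids b∉Ms survivors-⊆-endpoints ∷ proj₂ survivors-matching
      ; charged-⊆-endpoints = All.map there² charged-⊆-endpoints
      ; survivors-⊆-endpoints = here refl ∷ there (here refl) ∷ All.map there² survivors-⊆-endpoints }
      where open Charging c

    μ≤length+μ : ∀ {S T L μS μT} → (∀ {x} → x ∈ₛ S → x ∉ L → x ∈ₛ T) →
                 MaxMatchingSize G S μS → MaxMatchingSize G T μT → μS ≤ length L + μT
    μ≤length+μ {L = L} S∖L⊆T ((Ms , Ms-matching , refl) , _) (_ , μT-max) =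
      ≤-trans length-≤ (+-mono-≤ (unique-⊆⇒length≤ charged-unique charged-⊆-L) (μT-max survivors survivors-matching))
      where open Charging (charge S∖L⊆T Ms Ms-matching)

  module _ {n : ℕ} (V′ A′ : Subset n) where

    private
      D′ = V′ ─ A′

      both-in-A′ : ∀ {ℓ b} i → ℓ ≤ i + i + b → 2 + ℓ ≤ suc i + suc i + b
      both-in-A′ {ℓ} {b} i ℓ≤ = s≤s (subst (λ k → suc ℓ ≤ k + b) (sym (+-suc i i)) (s≤s ℓ≤))

      one-in-A′ : ∀ {ℓ b} i → ℓ ≤ i + i + b → 1 + ℓ ≤ i + i + suc b
      one-in-A′ {ℓ} {b} i ℓ≤ = subst (suc ℓ ≤_) (sym (+-suc (i + i) b)) (s≤s ℓ≤)

    data Side (x : Fin n) : Dec (x ∈ₛ A′) → Dec (x ∈ₛ D′) → Set where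
      in-A′ : (x∈A′ : x ∈ₛ A′) (x∉D′ : x ∉ₛ D′) → Side x (yes x∈A′) (no x∉D′)
      in-D′ : (x∉A′ : x ∉ₛ A′) (x∈D′ : x ∈ₛ D′) → Side x (no x∉A′) (yes x∈D′)

    side : ∀ {x} → x ∈ₛ V′ → Side x (x ∈? A′) (x ∈? D′)
    side {x} x∈V′ with x ∈? A′ | x ∈? D′
    ... | yes x∈A′ | yes x∈D′ = ⊥-elim (x∈p─q⇒x∉q x∈D′ x∈A′)
    ... | yes x∈A′ | no x∉D′ = in-A′ x∈A′ x∉D′
    ... | no x∉A′ | yes x∈D′ = in-D′ x∉A′ x∈D′
    ... | no x∉A′ | no x∉D′ = ⊥-elim (x∉D′ (x∈p∧x∉q⇒x∈p─q x∈V′ x∉A′))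

    A′-endpoints-≤ : (M : List (Edge n)) → All (λ (u , v) → u ∈ₛ V′ × v ∈ₛ V′) M →
      length (filter (_∈? A′) (endpoints M)) ≤ length (inside A′ M) + length (inside A′ M) + length (between A′ D′ M)
    A′-endpoints-≤ [] [] = z≤n
    A′-endpoints-≤ ((u , v) ∷ M) ((u∈V′ , v∈V′) ∷ M⊆V′)
      with u ∈? A′ | u ∈? D′ | side u∈V′
    ... | _ | _ | in-A′ _ _ with v ∈? A′ | v ∈? D′ | side v∈V′
    ...   | _ | _ | in-A′ _ _ = both-in-A′ (length (inside A′ M)) (A′-endpoints-≤ M M⊆V′)
    ...   | _ | _ | in-D′ _ _ = one-in-A′ (length (inside A′ M)) (A′-endpoints-≤ M M⊆V′)
    A′-endpoints-≤ ((u , v) ∷ M) ((u∈V′ , v∈V′) ∷ M⊆V′)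
      | _ | _ | in-D′ _ _ with v ∈? A′ | v ∈? D′ | side v∈V′
    ...   | _ | _ | in-A′ _ _ = one-in-A′ (length (inside A′ M)) (A′-endpoints-≤ M M⊆V′)
    ...   | _ | _ | in-D′ _ _ = A′-endpoints-≤ M M⊆V′

  μ≤2|M[A′]|+|M[A′,D′]|+μ : ∀ {n} (G : Graph n) (V′ A′ : Subset n) {M μA μR} → IsMatchingIn G V′ M →
    MaxMatchingSize G A′ μA → MaxMatchingSize G (A′ ─ covered M) μR →
    μA ≤ length (inside A′ M) + length (inside A′ M) + length (between A′ (V′ ─ A′) M) + μR
  μ≤2|M[A′]|+|M[A′,D′]|+μ G V′ A′ {M} (M⊆V′ , _) μA μR =
    ≤-trans (μ≤length+μ G A′∖L⊆A′∖V[M] μA μR)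
            (+-monoˡ-≤ _ (A′-endpoints-≤ V′ A′ M (All.map (λ (_ , u∈V′ , v∈V′) → u∈V′ , v∈V′) M⊆V′)))
    where
    A′∖L⊆A′∖V[M] : ∀ {x} → x ∈ₛ A′ → x ∉ filter (_∈? A′) (endpoints M) → x ∈ₛ A′ ─ covered M
    A′∖L⊆A′∖V[M] x∈A′ x∉L = x∈p∧x∉q⇒x∈p─q x∈A′ λ x∈V[M] →
      x∉L (∈-filter⁺ (_∈? A′) (∈-covered⇒∈-endpoints M x∈V[M]) x∈A′)

module ℕ→ℚ-Properties where

  open import Defs using (ℕ→ℚ)
  import Data.Nat as ℕ
  open import Data.Nat.Properties using (m+[n∸m]≡n)
  open import Data.Integer using (+_)
  open import Data.Rational using (0ℚ; _+_; _≤_; toℚᵘ)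
  open import Data.Rational.Properties using (toℚᵘ-injective; toℚᵘ-fromℚᵘ; toℚᵘ-homo-+; normalize-nonNeg; nonNegative⁻¹; +-monoʳ-≤; +-identityʳ; module ≤-Reasoning)
  import Data.Rational.Unnormalised as ℚᵘ
  import Data.Rational.Unnormalised.Properties as ℚᵘ
  import Data.Integer as ℤ
  import Data.Integer.Properties as ℤ
  open import Relation.Binary.PropositionalEquality using (_≡_; cong; cong₂; module ≡-Reasoning)

  mkℚᵘ-+-ℕ : ∀ a b → ℚᵘ.mkℚᵘ (+ (a ℕ.+ b)) 0 ℚᵘ.≃ ℚᵘ.mkℚᵘ (+ a) 0 ℚᵘ.+ ℚᵘ.mkℚᵘ (+ b) 0
  mkℚᵘ-+-ℕ a b = ℚᵘ.*≡* (begin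
    + (a ℕ.+ b) ℤ.* + 1                    ≡⟨ ℤ.*-identityʳ _ ⟩
    + a ℤ.+ + b                            ≡⟨ cong₂ ℤ._+_ (ℤ.*-identityʳ (+ a)) (ℤ.*-identityʳ (+ b)) ⟨
    + a ℤ.* + 1 ℤ.+ + b ℤ.* + 1            ≡⟨ ℤ.*-identityʳ _ ⟨
    (+ a ℤ.* + 1 ℤ.+ + b ℤ.* + 1) ℤ.* + 1  ∎)
    where open ≡-Reasoning

  ℕ→ℚ-+ : ∀ a b → ℕ→ℚ (a ℕ.+ b) ≡ ℕ→ℚ a + ℕ→ℚ b
  ℕ→ℚ-+ a b = toℚᵘ-injective (begin-equality
    toℚᵘ (ℕ→ℚ (a ℕ.+ b))                  ≃⟨ toℚᵘ-fromℚᵘ (ℚᵘ.mkℚᵘ (+ (a ℕ.+ b)) 0) ⟩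
    ℚᵘ.mkℚᵘ (+ (a ℕ.+ b)) 0               ≃⟨ mkℚᵘ-+-ℕ a b ⟩
    ℚᵘ.mkℚᵘ (+ a) 0 ℚᵘ.+ ℚᵘ.mkℚᵘ (+ b) 0  ≃⟨ ℚᵘ.+-cong (toℚᵘ-fromℚᵘ (ℚᵘ.mkℚᵘ (+ a) 0)) (toℚᵘ-fromℚᵘ (ℚᵘ.mkℚᵘ (+ b) 0)) ⟨
    toℚᵘ (ℕ→ℚ a) ℚᵘ.+ toℚᵘ (ℕ→ℚ b)        ≃⟨ toℚᵘ-homo-+ (ℕ→ℚ a) (ℕ→ℚ b) ⟨
    toℚᵘ (ℕ→ℚ a + ℕ→ℚ b)                  ∎)
    where open ℚᵘ.≤-Reasoning

  0≤ℕ→ℚ : ∀ k → 0ℚ ≤ ℕ→ℚ k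
  0≤ℕ→ℚ k = nonNegative⁻¹ (ℕ→ℚ k) {{normalize-nonNeg k 1}}

  ℕ→ℚ-mono-≤ : ∀ {a b} → a ℕ.≤ b → ℕ→ℚ a ≤ ℕ→ℚ b
  ℕ→ℚ-mono-≤ {a} {b} a≤b = begin
    ℕ→ℚ a                       ≡⟨ +-identityʳ (ℕ→ℚ a) ⟨
    ℕ→ℚ a + 0ℚ                  ≤⟨ +-monoʳ-≤ (ℕ→ℚ a) (0≤ℕ→ℚ (b ℕ.∸ a)) ⟩
    ℕ→ℚ a + ℕ→ℚ (b ℕ.∸ a)       ≡⟨ ℕ→ℚ-+ a (b ℕ.∸ a) ⟨
    ℕ→ℚ (a ℕ.+ (b ℕ.∸ a))       ≡⟨ cong ℕ→ℚ (m+[n∸m]≡n a≤b) ⟩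
    ℕ→ℚ b                       ∎
    where open ≤-Reasoning

module Inequalities where

  open import Defs using (δout)
  open import Data.Integer using (+_)
  open import Data.Rational
  open import Data.Rational.Properties
  open import Data.Rational.Solver using (module +-*-Solver)
  open import Relation.Binary.PropositionalEquality using (refl; subst; subst₂)
  open import Relation.Nullary.Decidable using (True; toWitness)
  open +-*-Solver

  0≤-decide : (p : ℚ) → {_ : True (0ℚ ≤? p)} → 0ℚ ≤ p
  0≤-decide p {w} = toWitness w

  p≤q⇒0≤q-p : ∀ {p q} → p ≤ q → 0ℚ ≤ q - p
  p≤q⇒0≤q-p {p} {q} p≤q = subst (_≤ q - p) (+-inverseʳ p) (+-monoˡ-≤ (- p) p≤q)

  0≤q-p⇒p≤q : ∀ {p q} → 0ℚ ≤ q - p → p ≤ q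
  0≤q-p⇒p≤q {p} {q} 0≤q-p = subst₂ _≤_ (+-identityˡ p) (solve 2 (λ p q → (q :- p) :+ p := q) refl p q) (+-monoˡ-≤ p 0≤q-p)

  0≤+ : ∀ {p q} → 0ℚ ≤ p → 0ℚ ≤ q → 0ℚ ≤ p + q
  0≤+ = +-mono-≤

  0≤* : ∀ {p q} → 0ℚ ≤ p → 0ℚ ≤ q → 0ℚ ≤ p * q
  0≤* {p} {q} 0≤p 0≤q = nonNegative⁻¹ (p * q) {{nonNeg*nonNeg⇒nonNeg p {{nonNegative 0≤p}} q {{nonNegative 0≤q}}}}

  δN≤N : ∀ δ N {a} → δ * N * (+ 1 / 2) ≤ a → a + a ≤ N → δ * N ≤ N
  δN≤N δ N {a} δN/2≤a a+a≤N = begin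
    δ * N                                 ≡⟨ solve 2 (λ δ N → δ :* N := δ :* N :* con (+ 1 / 2) :+ δ :* N :* con (+ 1 / 2)) refl δ N ⟩
    δ * N * (+ 1 / 2) + δ * N * (+ 1 / 2) ≤⟨ +-mono-≤ δN/2≤a δN/2≤a ⟩
    a + a                                 ≤⟨ a+a≤N ⟩
    N                                     ∎
    where open ≤-Reasoning

  δout*N≤δ*N/10⁸ : ∀ δ N → 0ℚ ≤ δ → δ * N ≤ N → δout δ * N ≤ δ * N * (+ 1 / 100000000)
  δout*N≤δ*N/10⁸ δ N 0≤δ δN≤N = 0≤q-p⇒p≤q (subst (0ℚ ≤_)
    (solve 3 (λ δ N k → (N :- δ :* N) :* (δ :* k :* (con 1ℚ :+ δ :+ δ :* δ :+ δ :* δ :* δ))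
                        := δ :* N :* k :- δ :* δ :* δ :* δ :* δ :* k :* N) refl δ N (+ 1 / 100000000))
    (0≤* (p≤q⇒0≤q-p δN≤N) (0≤* (0≤* 0≤δ (0≤-decide (+ 1 / 100000000)))
      (0≤+ (0≤+ (0≤+ (0≤-decide 1ℚ) 0≤δ) (0≤* 0≤δ 0≤δ)) (0≤* (0≤* 0≤δ 0≤δ) 0≤δ)))))

  -- b − δN/3 is a nonnegative combination of the slacks of the hypotheses.
  δN/3≤b : ∀ δ N d {a i b r} → 0ℚ ≤ δ * N → d * N ≤ δ * N * (+ 1 / 100000000) →
    δ * N * (+ 1 / 2) ≤ a → a ≤ i + i + b + r →
    i < (+ 3 / 1) * d * N → r < (+ 16 / 1) * d * N → δ * N * (+ 1 / 3) ≤ b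
  δN/3≤b δ N d {a} {i} {b} {r} 0≤δN dN≤ δN/2≤a a≤ i< r< = 0≤q-p⇒p≤q (subst (0ℚ ≤_)
    (solve 7 (λ δ N d a i b r →
        (a :- δ :* N :* con (+ 1 / 2)) :+ (i :+ i :+ b :+ r :- a)
        :+ con (+ 2 / 1) :* (con (+ 3 / 1) :* d :* N :- i) :+ (con (+ 16 / 1) :* d :* N :- r)
        :+ con (+ 22 / 1) :* (δ :* N :* con (+ 1 / 100000000) :- d :* N)
        :+ con (+ 1 / 6 - + 22 / 100000000) :* (δ :* N)
      := b :- δ :* N :* con (+ 1 / 3)) refl δ N d a i b r)
    (0≤+ (0≤+ (0≤+ (0≤+ (0≤+ (p≤q⇒0≤q-p δN/2≤a) (p≤q⇒0≤q-p a≤))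
      (0≤* (0≤-decide (+ 2 / 1)) (p≤q⇒0≤q-p (<⇒≤ i<)))) (p≤q⇒0≤q-p (<⇒≤ r<)))
      (0≤* (0≤-decide (+ 22 / 1)) (p≤q⇒0≤q-p dN≤)))
      (0≤* (0≤-decide (+ 1 / 6 - + 22 / 100000000)) 0≤δN)))

open import Defs
open import Data.Nat using (ℕ)
open import Data.Fin.Subset using (Subset; _⊆_; _─_)
open import Data.List using (List; length)
open import Data.Integer using (+_)
open import Data.Rational using (ℚ; 0ℚ; _/_; _*_; _<_; _≤_; _+_)
open import Data.Rational.Properties using (<⇒≤)
import Data.Nat as ℕ
open import Relation.Binary.PropositionalEquality using (subst; trans; cong)
open Matchings using (μ+μ≤n; μ≤2|M[A′]|+|M[A′,D′]|+μ)
open ℕ→ℚ-Properties using (ℕ→ℚ-+; ℕ→ℚ-mono-≤; 0≤ℕ→ℚ)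
open Inequalities using (0≤*; δN≤N; δout*N≤δ*N/10⁸; δN/3≤b)

lemma4p10 : (n : ℕ) (G : Graph n) (δin : ℚ) → 0ℚ < δin →
    (V′ A′ : Subset n) → A′ ⊆ V′ →
    (μA : ℕ) → MaxMatchingSize G A′ μA →
    δin * ℕ→ℚ n * (+ 1 / 2) ≤ ℕ→ℚ μA →
    (M : List (Edge n)) → IsMatchingIn G V′ M →
    ℕ→ℚ (length (inside A′ M)) < (+ 3 / 1) * δout δin * ℕ→ℚ n →
    (μR : ℕ) → MaxMatchingSize G (A′ ─ covered M) μR →
    ℕ→ℚ μR < (+ 16 / 1) * δout δin * ℕ→ℚ n →
    δin * ℕ→ℚ n * (+ 1 / 3) ≤ ℕ→ℚ (length (between A′ (V′ ─ A′) M))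
lemma4p10 n G δin 0<δin V′ A′ _ μA μA-max δn/2≤μA M M-matching |M[A′]|< μR μR-max μR< =
  δN/3≤b δin (ℕ→ℚ n) (δout δin) (0≤* 0≤δin (0≤ℕ→ℚ n)) (δout*N≤δ*N/10⁸ δin (ℕ→ℚ n) 0≤δin δn≤n)
         δn/2≤μA μA≤ |M[A′]|< μR<
  where
  0≤δin : 0ℚ ≤ δin
  0≤δin = <⇒≤ 0<δin

  I B : ℕ
  I = length (inside A′ M)
  B = length (between A′ (V′ ─ A′) M)

  δn≤n : δin * ℕ→ℚ n ≤ ℕ→ℚ n
  δn≤n = δN≤N δin (ℕ→ℚ n) δn/2≤μA (subst (_≤ ℕ→ℚ n) (ℕ→ℚ-+ μA μA) (ℕ→ℚ-mono-≤ (μ+μ≤n G μA-max)))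

  μA≤ : ℕ→ℚ μA ≤ ℕ→ℚ I + ℕ→ℚ I + ℕ→ℚ B + ℕ→ℚ μR
  μA≤ = subst (ℕ→ℚ μA ≤_)
    (trans (ℕ→ℚ-+ (I ℕ.+ I ℕ.+ B) μR)
      (cong (_+ ℕ→ℚ μR) (trans (ℕ→ℚ-+ (I ℕ.+ I) B) (cong (_+ ℕ→ℚ B) (ℕ→ℚ-+ I I)))))
    (ℕ→ℚ-mono-≤ (μ≤2|M[A′]|+|M[A′,D′]|+μ G V′ A′ M-matching μA-max μR-max))
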